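{- Let $m\geq 2$ be an integer and let $t$ be a positive integer such that $p:=\gcd(m,t)$ is a prime and $t+p=3m$. Define a sequence $(c(n))_{n\geq m-1}$ by $c(m-1)=t$ and, for $n\geq m$, $$c(n)=c(n-1)+\gcd(n,\,c(n-1)).$$ Then for every $n\geq m$, the difference $c(n)-c(n-1)$ is either $1$ or a prime. -}

module Defs where

open import Data.Nat using (ℕ; zero; suc; _+_; _∸_)
open import Data.Nat.GCD using (gcd)

-- cSeq m t k = c(m - 1 + k), where c(m-1) = t and
-- c(n) = c(n-1) + gcd(n, c(n-1)) for n ≥ m.
-- For k+1, n = m - 1 + (k+1) = m + k (valid as m ≥ 1).
cSeq : ℕ → ℕ → ℕ → ℕ
cSeq m t zero = t
cSeq m t (suc k) = cSeq m t k + gcd (m + k) (cSeq m t k)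

-- c as a function of n (meaningful for n ≥ m - 1)
c : ℕ → ℕ → ℕ → ℕ
c m t n = cSeq m t (n ∸ (m ∸ 1))

module Submission where

open import Defs
open import Data.Nat.Base
open import Data.Nat.Properties
open import Data.Nat.Divisibility
open import Data.Nat.GCD using (gcd; gcd[m,n]∣m; gcd[m,n]∣n; gcd-greatest)
open import Data.Nat.Coprimality using (Coprime; coprime-divisor)
open import Data.Nat.Primality
  using (Prime; _Rough_; 2-rough; ∤⇒rough-suc; rough∧∣⇒prime)
open import Data.Nat.Tactic.RingSolver using (solve-∀)
open import Data.Product using (_×_; _,_)
open import Data.Sum using (_⊎_; inj₁; inj₂)
open import Relation.Nullary using (yes; no; contradiction)
open import Relation.Binary.PropositionalEquality

-- Call N a phase start if c(N) = 3N, as for N = m.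
-- Within the phase c(n) = (n + 1) + o with o = 2N − 1 odd, so
-- gcd(n + 1, c(n)) divides both o and e = 2(n + 1) − o = 2(n − N) + 3.
-- All earlier gcds of the phase being 1 makes o (e − 1)-rough, hence e-rough.
-- So the gcd is either 1, and the phase goes on, or e itself; then e is the
-- least non-trivial divisor of o, hence prime, and c(n + 1) = 3(n + 1)
-- starts a new phase.

OneOrPrime : ℕ → Set
OneOrPrime d = d ≡ 1 ⊎ Prime d

2∤1+2* : ∀ n → 2 ∤ 1 + 2 * n
2∤1+2* n (divides q eq) = even≢odd q n (trans (*-comm 2 q) (sym eq))

2*∤1+2* : ∀ j n → 2 * j ∤ 1 + 2 * n
2*∤1+2* j n 2j∣o = 2∤1+2* n (∣-trans (m∣m*n j) 2j∣o)

∣1+2*⇒2∤ : ∀ {d} n → d ∣ 1 + 2 * n → 2 ∤ d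
∣1+2*⇒2∤ n d∣o 2∣d = 2∤1+2* n (∣-trans 2∣d d∣o)

2∤⇒coprime : ∀ {d} → 2 ∤ d → Coprime d 2
2∤⇒coprime 2∤d {0}          (_ , 0∣2) = contradiction (0∣⇒≡0 0∣2) λ ()
2∤⇒coprime 2∤d {1}          _         = refl
2∤⇒coprime 2∤d {2}          (2∣d , _) = contradiction 2∣d 2∤d
2∤⇒coprime 2∤d {2+ (suc _)} (_ , x∣2) = contradiction x∣2 (>⇒∤ (s<s (s<s z<s)))

rough∧∣∧<⇒≡1 : ∀ {d m n} → .{{NonZero n}} → m Rough n → d ∣ n → d < m → d ≡ 1
rough∧∣∧<⇒≡1 {0}    _ 0∣n _   = contradiction (0∣⇒≡0 0∣n) (≢-nonZero⁻¹ _)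
rough∧∣∧<⇒≡1 {1}    _ _   _   = refl
rough∧∣∧<⇒≡1 {2+ _} r d∣n d<m = contradiction (hasNonTrivialDivisor d<m d∣n) r

-- v stands for c(n), with n taken k steps past the phase start N = suc M;
-- the roughness bound records that the k gcds since N were all 1.
record Phase (n v : ℕ) : Set where
  constructor phase
  field
    k M   : ℕ
    index : n ≡ k + suc M
    value : v ≡ k + 3 * suc M
    rough : (2 * suc k) Rough (1 + 2 * M)

private
  phase-value-split : ∀ k M → k + 3 * suc M ≡ suc (k + suc M) + (1 + 2 * M)
  phase-value-split = solve-∀

  phase-double-index : ∀ k M → 2 * suc (k + suc M) ≡ (1 + 2 * M) + suc (2 * suc k)
  phase-double-index = solve-∀

  phase-restart : ∀ k M → k + 3 * suc M + suc (2 * suc k) ≡ 3 * suc (k + suc M)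
  phase-restart = solve-∀

module _ (k M : ℕ) (rough : (2 * suc k) Rough (1 + 2 * M)) where
  private
    n v o e g : ℕ
    n = k + suc M
    v = k + 3 * suc M
    o = 1 + 2 * M
    e = suc (2 * suc k)
    g = gcd (suc n) v

    g∣o : g ∣ o
    g∣o = ∣m+n∣m⇒∣n (subst (g ∣_) (phase-value-split k M) (gcd[m,n]∣n (suc n) v))
                    (gcd[m,n]∣m (suc n) v)

    g∣e : g ∣ e
    g∣e = ∣m+n∣m⇒∣n (subst (g ∣_) (phase-double-index k M)
                              (∣-trans (gcd[m,n]∣m (suc n) v) (n∣m*n 2)))
                    g∣o

    -- e is odd, so from e ∣ o it divides 2(n + 1) = o + e and hence n + 1.
    e∣o⇒e∣g : e ∣ o → e ∣ g
    e∣o⇒e∣g e∣o = gcd-greatest e∣1+n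
      (subst (e ∣_) (sym (phase-value-split k M)) (∣m∣n⇒∣m+n e∣1+n e∣o))
      where
      e∣1+n : e ∣ suc n
      e∣1+n = coprime-divisor (2∤⇒coprime (∣1+2*⇒2∤ M e∣o))
                (subst (e ∣_) (sym (phase-double-index k M)) (∣m∣n⇒∣m+n e∣o ∣-refl))

    e-rough : e Rough o
    e-rough = ∤⇒rough-suc (2*∤1+2* (suc k) M) rough

  phase-dichotomy : (gcd (suc n) v ≡ 1 × (2 * suc (suc k)) Rough o)
                  ⊎ (gcd (suc n) v ≡ e × Prime e)
  phase-dichotomy with e ∣? o
  ... | yes e∣o = inj₂ (∣-antisym g∣e (e∣o⇒e∣g e∣o) , rough∧∣⇒prime e-rough e∣o)
  ... | no e∤o  = inj₁ (rough∧∣∧<⇒≡1 [1+e]-rough g∣o (s≤s (∣⇒≤ g∣e)) ,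
                       subst (_Rough o) (sym (*-suc 2 (suc k))) [1+e]-rough)
    where
    [1+e]-rough : suc e Rough o
    [1+e]-rough = ∤⇒rough-suc e∤o e-rough

phase-gcd : ∀ {n v} → Phase n v → OneOrPrime (gcd (suc n) v)
phase-gcd (phase k M refl refl rough) with phase-dichotomy k M rough
... | inj₁ (g≡1 , _)       = inj₁ g≡1
... | inj₂ (g≡e , e-prime) = inj₂ (subst Prime (sym g≡e) e-prime)

phase-next : ∀ {n v} → Phase n v → Phase (suc n) (v + gcd (suc n) v)
phase-next (phase k M refl refl rough) with phase-dichotomy k M rough
... | inj₁ (g≡1 , rough′) =
  phase (suc k) M refl (trans (cong (k + 3 * suc M +_) g≡1) (+-comm _ 1)) rough′
... | inj₂ (g≡e , _)      =
  phase 0 (k + suc M) refl (trans (cong (k + 3 * suc M +_) g≡e) (phase-restart k M)) 2-rough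

module _ {M t : ℕ} (t+p≡3m : t + gcd (suc M) t ≡ 3 * suc M) where

  phases : ∀ k → Phase (suc M + k) (cSeq (suc M) t (suc k))
  phases zero    = phase 0 M (+-identityʳ (suc M))
                     (trans (cong (λ i → t + gcd i t) (+-identityʳ (suc M))) t+p≡3m) 2-rough
  phases (suc k) = subst (λ i → Phase i (x + gcd i x)) (sym (+-suc (suc M) k))
                     (phase-next (phases k))
    where
    x : ℕ
    x = cSeq (suc M) t (suc k)

  increment-oneOrPrime : Prime (gcd (suc M) t) →
                         ∀ k → OneOrPrime (gcd (suc M + k) (cSeq (suc M) t k))
  increment-oneOrPrime p-prime zero    =
    inj₂ (subst (λ i → Prime (gcd i t)) (sym (+-identityʳ (suc M))) p-prime)
  increment-oneOrPrime _       (suc k) =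
    subst (λ i → OneOrPrime (gcd i (cSeq (suc M) t (suc k)))) (sym (+-suc (suc M) k))
      (phase-gcd (phases k))

c-increment : ∀ M t k → c (suc M) t (suc M + k) ∸ c (suc M) t (suc M + k ∸ 1)
                        ≡ gcd (suc M + k) (cSeq (suc M) t k)
c-increment M t k = begin
  c (suc M) t (suc M + k) ∸ c (suc M) t (M + k)
    ≡⟨ cong₂ (λ i j → cSeq (suc M) t i ∸ cSeq (suc M) t j) index-now index-before ⟩
  cSeq (suc M) t (suc k) ∸ cSeq (suc M) t k
    ≡⟨ m+n∸m≡n (cSeq (suc M) t k) _ ⟩
  gcd (suc M + k) (cSeq (suc M) t k)
    ∎
  where
  open ≡-Reasoning
  index-now : suc M + k ∸ M ≡ suc k
  index-now = trans (cong (_∸ M) (sym (+-suc M k))) (m+n∸m≡n M (suc k))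
  index-before : M + k ∸ M ≡ k
  index-before = m+n∸m≡n M k

theorem2 : (m t : ℕ) → 2 ≤ m → 1 ≤ t → Prime (gcd m t) → t + gcd m t ≡ 3 * m →
           (n : ℕ) → m ≤ n →
           (c m t n ∸ c m t (n ∸ 1) ≡ 1) ⊎ Prime (c m t n ∸ c m t (n ∸ 1))
theorem2 (suc M) t _ _ p-prime t+p≡3m n m≤n with m≤n⇒∃[o]m+o≡n m≤n
... | k , refl =
  subst OneOrPrime (sym (c-increment M t k)) (increment-oneOrPrime t+p≡3m p-prime k)
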